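{- Let $G=(V,E)$ be a graph, let $H\subseteq E$ be an EDBS of $G$, and let $U\subseteq E\setminus H$ be the set of edges that are underfull w.r.t. $H$. Then either $\mu(G)\le(1/\Theta(\epsilon))\cdot\mu(H)$ or $\mu(G)\le(1+\Theta(\epsilon))\cdot\mu(H\cup U)$.
   Context: $\epsilon\in(0,1)$ is a small constant and $\beta:=1/\Theta(\epsilon^3)$. For $H\subseteq E$ and a vertex $x$, $\deg_x(H)$ is the number of edges of $H$ incident on $x$; for $e=(u,v)$, $\deg_e(H):=\deg_u(H)+\deg_v(H)$. An edge $e\in E$ is underfull w.r.t. $H$ iff $\deg_e(H)<(1-\epsilon)\beta$ and overfull iff $\deg_e(H)>\beta$. $H\subseteq E$ is an EDBS (edge degree bounded subgraph) of $G$ iff no edge of $H$ is overfull w.r.t. $H$. $\mu(\cdot)$ denotes maximum matching size. The $\Theta(\epsilon)$ terms denote quantities bounded above and below by absolute constants times $\epsilon$. -}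

module Defs where

open import Data.Nat using (ℕ)
open import Data.Fin using (Fin; _≟_)
open import Data.Fin.Subset using (Subset; _∈_; _∉_; _⊆_; ∣_∣; _∩_)
open import Data.Product using (_×_; proj₁; proj₂; Σ; _,_)
open import Data.Bool using (_∨_)
open import Data.Vec using (tabulate)
open import Data.Integer using (+_)
open import Data.Rational using (ℚ; _/_; _+_; _*_; _-_; _<_; _>_; _≤_; 1ℚ)
open import Relation.Nullary using (¬_)
open import Relation.Nullary.Decidable using (⌊_⌋)
open import Relation.Binary.PropositionalEquality using (_≡_; _≢_)

EdgeList : ℕ → ℕ → Set
EdgeList n m = Fin m → Fin n × Fin n

-- simple graph: no loops, no parallel edges (edges are unordered pairs)
Simple : ∀ {n m} → EdgeList n m → Set
Simple {n} {m} E =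
  (∀ i → proj₁ (E i) ≢ proj₂ (E i)) ×
  (∀ i j → (proj₁ (E i) ≡ proj₁ (E j) × proj₂ (E i) ≡ proj₂ (E j)
            Data.Sum.⊎ proj₁ (E i) ≡ proj₂ (E j) × proj₂ (E i) ≡ proj₁ (E j)) → i ≡ j)
  where import Data.Sum

incident : ∀ {n m} → EdgeList n m → Fin n → Subset m
incident E x = tabulate (λ i → ⌊ x ≟ proj₁ (E i) ⌋ ∨ ⌊ x ≟ proj₂ (E i) ⌋)

deg : ∀ {n m} → EdgeList n m → Subset m → Fin n → ℕ
deg E H x = ∣ H ∩ incident E x ∣

edgeDeg : ∀ {n m} → EdgeList n m → Subset m → Fin m → ℕ
edgeDeg E H e = deg E H (proj₁ (E e)) Data.Nat.+ deg E H (proj₂ (E e))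
  where import Data.Nat

toℚ : ℕ → ℚ
toℚ k = + k / 1

Underfull : ∀ {n m} → EdgeList n m → (ε β : ℚ) → Subset m → Fin m → Set
Underfull E ε β H e = toℚ (edgeDeg E H e) < (1ℚ - ε) * β

Overfull : ∀ {n m} → EdgeList n m → (β : ℚ) → Subset m → Fin m → Set
Overfull E β H e = toℚ (edgeDeg E H e) > β

IsEDBS : ∀ {n m} → EdgeList n m → (β : ℚ) → Subset m → Set
IsEDBS E β H = ∀ e → e ∈ H → ¬ Overfull E β H e

IsMatching : ∀ {n m} → EdgeList n m → Subset m → Set
IsMatching E M = ∀ i j → i ∈ M → j ∈ M → i ≢ j →
  proj₁ (E i) ≢ proj₁ (E j) × proj₁ (E i) ≢ proj₂ (E j) ×
  proj₂ (E i) ≢ proj₁ (E j) × proj₂ (E i) ≢ proj₂ (E j)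

IsMaxMatchingSize : ∀ {n m} → EdgeList n m → Subset m → ℕ → Set
IsMaxMatchingSize E H k =
  Σ (Subset _) (λ M → M ⊆ H × IsMatching E M × ∣ M ∣ ≡ k) ×
  (∀ M → M ⊆ H → IsMatching E M → ∣ M ∣ Data.Nat.≤ k)
  where import Data.Nat

-- Split a maximum matching of G into its edges inside H ∪ U, which form a matching of H ∪ U,
-- and the remaining edges B. An edge e of B is outside H and not underfull, so
-- deg_e(H) ≥ (1-ε)β while deg_g(H) ≤ β on H; with β ε³ = 1/8 this gives
-- deg_e(H) ≥ 1 and deg_g(H) ≤ 2 deg_e(H) for g ∈ H. Counting incidences between B and H
-- gives Σ_{e∈B} deg_e(H) ≤ 4|H|, and since every edge of H meets a maximum matching M_H of H,
-- |H| ≤ Σ_{g∈M_H} deg_g(H) ≤ μ(H) · max_{g∈M_H} deg_g(H). Hence |B| ≤ 12 μ(H), so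
-- μ(G) ≤ μ(H ∪ U) + 12 μ(H), and either 24 μ(H) ≥ ε μ(G) or μ(G) ≤ (1 + ε) μ(H ∪ U).
module Submission where

open import Defs
open import Data.Nat using (ℕ)

module FiniteSums where

  open import Data.Bool.Base using (Bool; true; false; _∧_)
  open import Data.Fin.Base using (Fin; zero; suc)
  open import Data.Fin.Properties using (0≢1+n; suc-injective)
  open import Data.Fin.Subset using (Subset; _∈_; _∉_; _∩_; _∪_; ∁; ⁅_⁆; ∣_∣; inside; outside)
  open import Data.Fin.Subset.Properties using (Empty-unique; ∣⊥∣≡0; ∪-identityʳ)
  open import Data.Nat.Base using (ℕ; zero; suc; _+_; _*_; _⊔_; _≤_; z≤n; s≤s)
  open import Data.Nat.Properties hiding (suc-injective; 0≢1+n)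
  open import Data.Product using (_,_)
  open import Data.Vec.Base using (_∷_; []; lookup; here; there)
  open import Data.Vec.Properties using (lookup-zipWith; []=⇒lookup)
  open import Function.Base using (_∘_)
  open import Relation.Binary.PropositionalEquality using (_≡_; refl; sym; trans; cong; subst; module ≡-Reasoning)
  open import Relation.Nullary.Negation using (contradiction)
  open import Algebra.Properties.CommutativeSemigroup *-commutativeSemigroup using (x∙yz≈y∙xz)
  open import Algebra.Properties.Semiring.Sum +-*-semiring
    using (sum; ∑-comm; ∑-distrib-+; *-distribˡ-sum; sum-remove; sum-cong-≗)

  private variable
    k l c : ℕ
    i : Fin k
    p : Subset k
    f g : Fin k → ℕ

  𝟙 : Bool → ℕ
  𝟙 true  = 1
  𝟙 false = 0

  χ : Subset k → Fin k → ℕ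
  χ p i = 𝟙 (lookup p i)

  sumOver : Subset k → (Fin k → ℕ) → ℕ
  sumOver p f = sum (λ i → χ p i * f i)

  infixl 10 sumOver
  syntax sumOver p (λ i → x) = ∑[ i ∈ p ] x

  ∑-mono-≤ : (∀ i → f i ≤ g i) → sum f ≤ sum g
  ∑-mono-≤ {zero}  f≤g = z≤n
  ∑-mono-≤ {suc k} f≤g = +-mono-≤ (f≤g zero) (∑-mono-≤ (f≤g ∘ suc))

  term≤sum : (f : Fin k → ℕ) (i : Fin k) → f i ≤ sum f
  term≤sum {suc k} f i = ≤-trans (m≤m+n (f i) _) (≤-reflexive (sym (sum-remove f)))

  ∣p∣≡sumχ : (p : Subset k) → ∣ p ∣ ≡ sum (χ p)
  ∣p∣≡sumχ []            = refl
  ∣p∣≡sumχ (inside  ∷ p) = cong suc (∣p∣≡sumχ p)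
  ∣p∣≡sumχ (outside ∷ p) = ∣p∣≡sumχ p

  χ-∩ : (p q : Subset k) (i : Fin k) → χ (p ∩ q) i ≡ χ p i * χ q i
  χ-∩ p q i rewrite lookup-zipWith _∧_ i p q with lookup p i
  ... | true  = sym (+-identityʳ _)
  ... | false = refl

  ∣p∩q∣≡∑χ : (p q : Subset k) → ∣ p ∩ q ∣ ≡ ∑[ i ∈ p ] χ q i
  ∣p∩q∣≡∑χ p q = trans (∣p∣≡sumχ (p ∩ q)) (sum-cong-≗ (χ-∩ p q))

  χ*-mono-≤ : ∀ {a b} → (i ∈ p → a ≤ b) → χ p i * a ≤ χ p i * b
  χ*-mono-≤ {i = zero}  {inside  ∷ p} a≤b = *-monoʳ-≤ 1 (a≤b here)
  χ*-mono-≤ {i = zero}  {outside ∷ p} a≤b = z≤n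
  χ*-mono-≤ {i = suc i} {_       ∷ p} a≤b = χ*-mono-≤ (a≤b ∘ there)

  χ-∈ : i ∈ p → χ p i ≡ 1
  χ-∈ i∈p = cong 𝟙 ([]=⇒lookup i∈p)

  χ≤ : (i ∈ p → 1 ≤ c) → χ p i ≤ c
  χ≤ {i = zero}  {inside  ∷ p} 1≤c = 1≤c here
  χ≤ {i = zero}  {outside ∷ p} 1≤c = z≤n
  χ≤ {i = suc i} {_       ∷ p} 1≤c = χ≤ (1≤c ∘ there)

  ∑∈-cong : (p : Subset k) → (∀ i → f i ≡ g i) → ∑[ i ∈ p ] f i ≡ ∑[ i ∈ p ] g i
  ∑∈-cong p f≡g = sum-cong-≗ (λ i → cong (χ p i *_) (f≡g i))

  ∑∈-mono-≤ : (p : Subset k) → (∀ i → i ∈ p → f i ≤ g i) → ∑[ i ∈ p ] f i ≤ ∑[ i ∈ p ] g i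
  ∑∈-mono-≤ p f≤g = ∑-mono-≤ (λ i → χ*-mono-≤ (f≤g i))

  ∑∈-distrib-+ : (p : Subset k) (f g : Fin k → ℕ) →
                 ∑[ i ∈ p ] (f i + g i) ≡ ∑[ i ∈ p ] f i + ∑[ i ∈ p ] g i
  ∑∈-distrib-+ p f g = trans (sum-cong-≗ (λ i → *-distribˡ-+ (χ p i) (f i) (g i)))
                             (∑-distrib-+ (λ i → χ p i * f i) (λ i → χ p i * g i))

  ∑∈-*ˡ : ∀ c (p : Subset k) (f : Fin k → ℕ) → ∑[ i ∈ p ] (c * f i) ≡ c * ∑[ i ∈ p ] f i
  ∑∈-*ˡ c p f = sym (trans (*-distribˡ-sum c (λ i → χ p i * f i))
                           (sum-cong-≗ (λ i → x∙yz≈y∙xz c (χ p i) (f i))))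

  ∑∈-const : ∀ c (p : Subset k) → ∑[ i ∈ p ] c ≡ c * ∣ p ∣
  ∑∈-const c p = begin
    sum (λ i → χ p i * c) ≡⟨ sum-cong-≗ (λ i → *-comm (χ p i) c) ⟩
    sum (λ i → c * χ p i) ≡⟨ *-distribˡ-sum c (χ p) ⟨
    c * sum (χ p)         ≡⟨ cong (c *_) (∣p∣≡sumχ p) ⟨
    c * ∣ p ∣             ∎
    where open ≡-Reasoning

  *∣p∣≤∑∈ : (p : Subset k) → (∀ i → i ∈ p → c ≤ f i) → c * ∣ p ∣ ≤ ∑[ i ∈ p ] f i
  *∣p∣≤∑∈ {c = c} p c≤f = subst (_≤ _) (∑∈-const c p) (∑∈-mono-≤ p c≤f)

  ∑∈≤*∣p∣ : (p : Subset k) → (∀ i → i ∈ p → f i ≤ c) → ∑[ i ∈ p ] f i ≤ c * ∣ p ∣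
  ∑∈≤*∣p∣ {c = c} p f≤c = subst (_ ≤_) (∑∈-const c p) (∑∈-mono-≤ p f≤c)

  ∑∈-comm : (p : Subset k) (q : Subset l) (f : Fin k → Fin l → ℕ) →
            ∑[ i ∈ p ] ∑[ j ∈ q ] f i j ≡ ∑[ j ∈ q ] ∑[ i ∈ p ] f i j
  ∑∈-comm p q f = begin
    sum (λ i → χ p i * sum (λ j → χ q j * f i j))
      ≡⟨ sum-cong-≗ (λ i → *-distribˡ-sum (χ p i) (λ j → χ q j * f i j)) ⟩
    sum (λ i → sum (λ j → χ p i * (χ q j * f i j)))
      ≡⟨ ∑-comm (λ i j → χ p i * (χ q j * f i j)) ⟩
    sum (λ j → sum (λ i → χ p i * (χ q j * f i j)))
      ≡⟨ sum-cong-≗ (λ j → sum-cong-≗ (λ i → x∙yz≈y∙xz (χ p i) (χ q j) (f i j))) ⟩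
    sum (λ j → sum (λ i → χ q j * (χ p i * f i j)))
      ≡⟨ sum-cong-≗ (λ j → *-distribˡ-sum (χ q j) (λ i → χ p i * f i j)) ⟨
    sum (λ j → χ q j * sum (λ i → χ p i * f i j)) ∎
    where open ≡-Reasoning

  ∑∈≡0⇒≡0 : ∑[ j ∈ p ] f j ≡ 0 → i ∈ p → f i ≡ 0
  ∑∈≡0⇒≡0 {p = p} {f = f} {i = i} ∑≡0 i∈p = n≤0⇒n≡0 (begin
    f i           ≡⟨ +-identityʳ (f i) ⟨
    1 * f i       ≡⟨ cong (_* f i) (χ-∈ i∈p) ⟨
    χ p i * f i   ≤⟨ term≤sum (λ j → χ p j * f j) i ⟩
    ∑[ j ∈ p ] f j ≡⟨ ∑≡0 ⟩
    0             ∎)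
    where open ≤-Reasoning

  ∣p∣≤1 : {p : Subset k} → (∀ {i j} → i ∈ p → j ∈ p → i ≡ j) → ∣ p ∣ ≤ 1
  ∣p∣≤1 {p = []}          _      = z≤n
  ∣p∣≤1 {p = outside ∷ p} unique = ∣p∣≤1 (λ i∈p j∈p → suc-injective (unique (there i∈p) (there j∈p)))
  ∣p∣≤1 {suc k} {inside  ∷ p} unique = s≤s (≤-reflexive (trans (cong ∣_∣ p≡⊥) (∣⊥∣≡0 k)))
    where p≡⊥ = Empty-unique (λ (i , i∈p) → 0≢1+n (unique here (there i∈p)))

  ∣p∣≡∣p∩q∣+∣p∩∁q∣ : (p q : Subset k) → ∣ p ∣ ≡ ∣ p ∩ q ∣ + ∣ p ∩ ∁ q ∣
  ∣p∣≡∣p∩q∣+∣p∩∁q∣ []            []            = refl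
  ∣p∣≡∣p∩q∣+∣p∩∁q∣ (outside ∷ p) (_       ∷ q) = ∣p∣≡∣p∩q∣+∣p∩∁q∣ p q
  ∣p∣≡∣p∩q∣+∣p∩∁q∣ (inside  ∷ p) (inside  ∷ q) = cong suc (∣p∣≡∣p∩q∣+∣p∩∁q∣ p q)
  ∣p∣≡∣p∩q∣+∣p∩∁q∣ (inside  ∷ p) (outside ∷ q) =
    trans (cong suc (∣p∣≡∣p∩q∣+∣p∩∁q∣ p q)) (sym (+-suc _ _))

  ∣p∪⁅i⁆∣≡1+∣p∣ : i ∉ p → ∣ p ∪ ⁅ i ⁆ ∣ ≡ suc ∣ p ∣
  ∣p∪⁅i⁆∣≡1+∣p∣ {i = zero}  {inside  ∷ p} i∉p = contradiction here i∉p
  ∣p∪⁅i⁆∣≡1+∣p∣ {i = zero}  {outside ∷ p} i∉p = cong (suc ∘ ∣_∣) (∪-identityʳ p)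
  ∣p∪⁅i⁆∣≡1+∣p∣ {i = suc i} {inside  ∷ p} i∉p = cong suc (∣p∪⁅i⁆∣≡1+∣p∣ (i∉p ∘ there))
  ∣p∪⁅i⁆∣≡1+∣p∣ {i = suc i} {outside ∷ p} i∉p = ∣p∪⁅i⁆∣≡1+∣p∣ (i∉p ∘ there)

  ⨆ : Subset k → (Fin k → ℕ) → ℕ
  ⨆ []            f = 0
  ⨆ (inside  ∷ p) f = f zero ⊔ ⨆ p (f ∘ suc)
  ⨆ (outside ∷ p) f = ⨆ p (f ∘ suc)

  ≤⨆ : i ∈ p → f i ≤ ⨆ p f
  ≤⨆ {i = zero}  {inside  ∷ p}         here      = m≤m⊔n _ _
  ≤⨆ {i = suc i} {inside  ∷ p} {f = f} (there i∈p) = ≤-trans (≤⨆ i∈p) (m≤n⊔m (f zero) _)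
  ≤⨆ {i = suc i} {outside ∷ p}         (there i∈p) = ≤⨆ i∈p

  ⨆-lub : (∀ i → i ∈ p → f i ≤ c) → ⨆ p f ≤ c
  ⨆-lub {p = []}          f≤c = z≤n
  ⨆-lub {p = inside  ∷ p} f≤c = ⊔-lub (f≤c zero here) (⨆-lub (λ i → f≤c (suc i) ∘ there))
  ⨆-lub {p = outside ∷ p} f≤c = ⨆-lub (λ i → f≤c (suc i) ∘ there)

module Matchings {n m : ℕ} (E : EdgeList n m) where

  open import Data.Fin.Base using (Fin)
  open import Data.Fin.Properties using (_≟_)
  open import Data.Fin.Subset using (Subset; _∈_; _∉_; _⊆_; _∪_; _∩_; ∁; ⁅_⁆; ∣_∣; ⊤)
  open import Data.Fin.Subset.Properties using (x∈p∪q⁻; x∈⁅y⁆⇒x≡y; x∈p∩q⁻; p∩q⊆p; p∩q⊆q; x∈∁p⇒x∉p)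
  open import Data.Nat.Base using (ℕ; suc; _+_; _*_; _≤_)
  open import Data.Nat.Properties hiding (_≟_)
  open import Data.Product using (_×_; _,_; proj₁; proj₂)
  open import Data.Sum using (_⊎_; inj₁; inj₂; [_,_])
  import Data.Sum as Sum
  open import Data.Vec.Properties using (lookup∘tabulate; []=⇒lookup; lookup⇒[]=)
  open import Data.Bool.Base using (true; _∨_)
  open import Function.Base using (_∘_)
  open import Relation.Binary.PropositionalEquality using (_≡_; _≢_; refl; sym; trans; cong; cong₂; subst)
  open import Relation.Nullary using (¬_; yes; no)
  open import Relation.Nullary.Negation using (contradiction)
  open import Relation.Nullary.Decidable using (⌊_⌋)
  open import Data.Nat.Solver using (module +-*-Solver)
  open +-*-Solver using (solve; _:*_; _:=_; con)
  open FiniteSums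

  private variable
    x : Fin n
    e h : Fin m
    M : Subset m

  end₁ end₂ : Fin m → Fin n
  end₁ e = proj₁ (E e)
  end₂ e = proj₂ (E e)

  Disjoint : Fin m → Fin m → Set
  Disjoint i j = end₁ i ≢ end₁ j × end₁ i ≢ end₂ j × end₂ i ≢ end₁ j × end₂ i ≢ end₂ j

  Disjoint-sym : ∀ {i j} → Disjoint i j → Disjoint j i
  Disjoint-sym (≢₁₁ , ≢₁₂ , ≢₂₁ , ≢₂₂) = ≢₁₁ ∘ sym , ≢₂₁ ∘ sym , ≢₁₂ ∘ sym , ≢₂₂ ∘ sym

  incident⁻ : h ∈ incident E x → x ≡ end₁ h ⊎ x ≡ end₂ h
  incident⁻ {h} {x} h∈ with x ≟ end₁ h | x ≟ end₂ h | trans (sym (lookup∘tabulate _ h)) ([]=⇒lookup h∈)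
  ... | yes x≡end₁ | _          | _ = inj₁ x≡end₁
  ... | no _       | yes x≡end₂ | _ = inj₂ x≡end₂
  ... | no _       | no _       | ()

  incident⁺ : x ≡ end₁ h ⊎ x ≡ end₂ h → h ∈ incident E x
  incident⁺ {x} {h} x∈h =
    lookup⇒[]= h (incident E x) (trans (lookup∘tabulate _ h) (is-end x∈h))
    where
    is-end : x ≡ end₁ h ⊎ x ≡ end₂ h → ⌊ x ≟ end₁ h ⌋ ∨ ⌊ x ≟ end₂ h ⌋ ≡ true
    is-end x∈h with x ≟ end₁ h | x ≟ end₂ h | x∈h
    ... | yes _     | _         | _           = refl
    ... | no _      | yes _     | _           = refl
    ... | no x≢end₁ | no _      | inj₁ x≡end₁ = contradiction x≡end₁ x≢end₁
    ... | no _      | no x≢end₂ | inj₂ x≡end₂ = contradiction x≡end₂ x≢end₂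

  1≤χ-incident : x ≡ end₁ h ⊎ x ≡ end₂ h → 1 ≤ χ (incident E x) h
  1≤χ-incident x∈h = ≤-reflexive (sym (χ-∈ (incident⁺ x∈h)))

  χ-incident≡0⇒≢ : χ (incident E x) h ≡ 0 → x ≢ end₁ h × x ≢ end₂ h
  χ-incident≡0⇒≢ χ≡0 = (λ x≡end₁ → m<n⇒n≢0 (1≤χ-incident (inj₁ x≡end₁)) χ≡0)
                     , (λ x≡end₂ → m<n⇒n≢0 (1≤χ-incident (inj₂ x≡end₂)) χ≡0)

  endsOn : Fin m → Fin m → ℕ
  endsOn e h = χ (incident E (end₁ e)) h + χ (incident E (end₂ e)) h

  contacts : Subset m → Fin m → ℕ
  contacts X h = ∑[ e ∈ X ] endsOn e h

  endsOn≡0⇒Disjoint : endsOn e h ≡ 0 → Disjoint e h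
  endsOn≡0⇒Disjoint {e} {h} ends≡0 =
    let ≢₁₁ , ≢₁₂ = χ-incident≡0⇒≢ (m+n≡0⇒m≡0 _ ends≡0)
        ≢₂₁ , ≢₂₂ = χ-incident≡0⇒≢ (m+n≡0⇒n≡0 _ ends≡0)
    in ≢₁₁ , ≢₁₂ , ≢₂₁ , ≢₂₂

  shared-endpoint⇒¬Disjoint : ∀ {i j} → x ≡ end₁ i ⊎ x ≡ end₂ i → x ≡ end₁ j ⊎ x ≡ end₂ j → ¬ Disjoint i j
  shared-endpoint⇒¬Disjoint (inj₁ x≡i) (inj₁ x≡j) (≢₁₁ , _) = ≢₁₁ (trans (sym x≡i) x≡j)
  shared-endpoint⇒¬Disjoint (inj₁ x≡i) (inj₂ x≡j) (_ , ≢₁₂ , _) = ≢₁₂ (trans (sym x≡i) x≡j)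
  shared-endpoint⇒¬Disjoint (inj₂ x≡i) (inj₁ x≡j) (_ , _ , ≢₂₁ , _) = ≢₂₁ (trans (sym x≡i) x≡j)
  shared-endpoint⇒¬Disjoint (inj₂ x≡i) (inj₂ x≡j) (_ , _ , _ , ≢₂₂) = ≢₂₂ (trans (sym x≡i) x≡j)

  IsMatching-⊆ : ∀ {A} → A ⊆ M → IsMatching E M → IsMatching E A
  IsMatching-⊆ A⊆M matching i j i∈A j∈A = matching i j (A⊆M i∈A) (A⊆M j∈A)

  IsMatching-∪⁅⁆ : IsMatching E M → (∀ e → e ∈ M → Disjoint e h) → IsMatching E (M ∪ ⁅ h ⁆)
  IsMatching-∪⁅⁆ {M} {h} matching far i j i∈ j∈ i≢j with x∈p∪q⁻ M ⁅ h ⁆ i∈ | x∈p∪q⁻ M ⁅ h ⁆ j∈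
  ... | inj₁ i∈M | inj₁ j∈M = matching i j i∈M j∈M i≢j
  ... | inj₁ i∈M | inj₂ j∈h rewrite x∈⁅y⁆⇒x≡y h j∈h = far i i∈M
  ... | inj₂ i∈h | inj₁ j∈M rewrite x∈⁅y⁆⇒x≡y h i∈h = Disjoint-sym (far j j∈M)
  ... | inj₂ i∈h | inj₂ j∈h = contradiction (trans (x∈⁅y⁆⇒x≡y h i∈h) (sym (x∈⁅y⁆⇒x≡y h j∈h))) i≢j

  IsMatching⇒deg≤1 : IsMatching E M → ∀ x → deg E M x ≤ 1
  IsMatching⇒deg≤1 {M} matching x = ∣p∣≤1 same
    where
    same : ∀ {i j} → i ∈ M ∩ incident E x → j ∈ M ∩ incident E x → i ≡ j
    same {i} {j} i∈ j∈ with i ≟ j | x∈p∩q⁻ M (incident E x) i∈ | x∈p∩q⁻ M (incident E x) j∈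
    ... | yes i≡j | _ | _ = i≡j
    ... | no i≢j | i∈M , x∈i | j∈M , x∈j =
      contradiction (matching i j i∈M j∈M i≢j)
                    (shared-endpoint⇒¬Disjoint (incident⁻ {x = x} x∈i) (incident⁻ {x = x} x∈j))

  IsMatching⇒edgeDeg≤2 : IsMatching E M → ∀ h → edgeDeg E M h ≤ 2
  IsMatching⇒edgeDeg≤2 matching h =
    +-mono-≤ (IsMatching⇒deg≤1 matching (end₁ h)) (IsMatching⇒deg≤1 matching (end₂ h))

  deg≡∑ : ∀ H x → deg E H x ≡ ∑[ h ∈ H ] χ (incident E x) h
  deg≡∑ H x = ∣p∩q∣≡∑χ H (incident E x)

  edgeDeg≡∑endsOn : ∀ H e → edgeDeg E H e ≡ ∑[ h ∈ H ] endsOn e h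
  edgeDeg≡∑endsOn H e = trans (cong₂ _+_ (deg≡∑ H (end₁ e)) (deg≡∑ H (end₂ e)))
                              (sym (∑∈-distrib-+ H _ _))

  ∑edgeDeg≡∑contacts : ∀ H X → ∑[ e ∈ X ] edgeDeg E H e ≡ ∑[ h ∈ H ] contacts X h
  ∑edgeDeg≡∑contacts H X = trans (∑∈-cong X (edgeDeg≡∑endsOn H)) (∑∈-comm X H endsOn)

  incidence-≤ : x ≡ end₁ e ⊎ x ≡ end₂ e →
                χ (incident E x) h ≤ χ (incident E (end₁ h)) e + χ (incident E (end₂ h)) e
  incidence-≤ {x} {e} {h} x∈e = χ≤ (λ h∈ → [ via-end₁ , via-end₂ ] (incident⁻ {x = x} h∈))
    where
    via-end₁ : x ≡ end₁ h → 1 ≤ χ (incident E (end₁ h)) e + χ (incident E (end₂ h)) e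
    via-end₁ x≡end₁ = ≤-trans (1≤χ-incident (Sum.map (trans (sym x≡end₁)) (trans (sym x≡end₁)) x∈e))
                              (m≤m+n _ _)
    via-end₂ : x ≡ end₂ h → 1 ≤ χ (incident E (end₁ h)) e + χ (incident E (end₂ h)) e
    via-end₂ x≡end₂ = ≤-trans (1≤χ-incident (Sum.map (trans (sym x≡end₂)) (trans (sym x≡end₂)) x∈e))
                              (m≤n+m _ _)

  contacts≤2*edgeDeg : ∀ X h → contacts X h ≤ 2 * edgeDeg E X h
  contacts≤2*edgeDeg X h = begin
    ∑[ e ∈ X ] endsOn e h
      ≤⟨ ∑∈-mono-≤ X (λ e _ → endsOn≤ e) ⟩
    ∑[ e ∈ X ] (incidences e + incidences e)
      ≡⟨ ∑∈-cong X (λ e → cong (incidences e +_) (sym (+-identityʳ (incidences e)))) ⟩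
    ∑[ e ∈ X ] (2 * incidences e)
      ≡⟨ ∑∈-*ˡ 2 X incidences ⟩
    2 * ∑[ e ∈ X ] incidences e
      ≡⟨ cong (2 *_) (∑∈-distrib-+ X _ _) ⟩
    2 * (∑[ e ∈ X ] χ (incident E (end₁ h)) e + ∑[ e ∈ X ] χ (incident E (end₂ h)) e)
      ≡⟨ cong (2 *_) (cong₂ _+_ (deg≡∑ X (end₁ h)) (deg≡∑ X (end₂ h))) ⟨
    2 * edgeDeg E X h ∎
    where
    open ≤-Reasoning
    incidences : Fin m → ℕ
    incidences e = χ (incident E (end₁ h)) e + χ (incident E (end₂ h)) e
    endsOn≤ : ∀ e → endsOn e h ≤ incidences e + incidences e
    endsOn≤ e = +-mono-≤ (incidence-≤ {e = e} (inj₁ refl)) (incidence-≤ {e = e} (inj₂ refl))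

  ∑edgeDeg≤4∣H∣ : ∀ H {B} → IsMatching E B → ∑[ e ∈ B ] edgeDeg E H e ≤ 4 * ∣ H ∣
  ∑edgeDeg≤4∣H∣ H {B} matching = begin
    ∑[ e ∈ B ] edgeDeg E H e ≡⟨ ∑edgeDeg≡∑contacts H B ⟩
    ∑[ h ∈ H ] contacts B h  ≤⟨ ∑∈≤*∣p∣ H (λ h _ → contacts≤4 h) ⟩
    4 * ∣ H ∣                ∎
    where
    open ≤-Reasoning
    contacts≤4 : ∀ h → contacts B h ≤ 4
    contacts≤4 h = ≤-trans (contacts≤2*edgeDeg B h) (*-monoʳ-≤ 2 (IsMatching⇒edgeDeg≤2 matching h))

  maximum⇒contacts≢0 : ∀ {H} → M ⊆ H → IsMatching E M →
                              (∀ M′ → M′ ⊆ H → IsMatching E M′ → ∣ M′ ∣ ≤ ∣ M ∣) →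
                              h ∈ H → contacts M h ≢ 0
  maximum⇒contacts≢0 {M} {h} {H} M⊆H matching maximum h∈H contacts≡0 =
    <-irrefl refl (subst (_≤ ∣ M ∣) (∣p∪⁅i⁆∣≡1+∣p∣ h∉M)
                         (maximum (M ∪ ⁅ h ⁆) M∪h⊆H (IsMatching-∪⁅⁆ matching far)))
    where
    far : ∀ e → e ∈ M → Disjoint e h
    far e e∈M = endsOn≡0⇒Disjoint (∑∈≡0⇒≡0 {f = λ e → endsOn e h} contacts≡0 e∈M)
    h∉M : h ∉ M
    h∉M h∈M = proj₁ (far h h∈M) refl
    M∪h⊆H : M ∪ ⁅ h ⁆ ⊆ H
    M∪h⊆H i∈ = [ M⊆H , (λ i∈h → subst (_∈ H) (sym (x∈⁅y⁆⇒x≡y h i∈h)) h∈H) ] (x∈p∪q⁻ M ⁅ h ⁆ i∈)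

  ∣H∣≤∑edgeDeg : ∀ {H} → M ⊆ H → IsMatching E M →
                 (∀ M′ → M′ ⊆ H → IsMatching E M′ → ∣ M′ ∣ ≤ ∣ M ∣) →
                 ∣ H ∣ ≤ ∑[ g ∈ M ] edgeDeg E H g
  ∣H∣≤∑edgeDeg {M} {H} M⊆H matching maximum = begin
    ∣ H ∣                    ≡⟨ *-identityˡ ∣ H ∣ ⟨
    1 * ∣ H ∣                ≤⟨ *∣p∣≤∑∈ H (λ h → n≢0⇒n>0 ∘ maximum⇒contacts≢0 M⊆H matching maximum) ⟩
    ∑[ h ∈ H ] contacts M h  ≡⟨ ∑edgeDeg≡∑contacts H M ⟨
    ∑[ g ∈ M ] edgeDeg E H g ∎
    where open ≤-Reasoning

  Heavy : Subset m → Fin m → Set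
  Heavy H e = 1 ≤ edgeDeg E H e × (∀ g → g ∈ H → edgeDeg E H g ≤ 2 * edgeDeg E H e)

  heavy-matching-bound : ∀ {H B μ} → IsMaxMatchingSize E H μ → IsMatching E B →
                         (∀ e → e ∈ B → Heavy H e) → ∣ B ∣ ≤ 12 * μ
  -- X bounds the H-degrees on M; multiplying by 1 + X rather than X avoids the case X = 0.
  heavy-matching-bound {H} {B} ((M , M⊆H , M-matching , refl) , maximum) B-matching heavy =
    *-cancelˡ-≤ (suc X) (begin
      suc X * ∣ B ∣                ≤⟨ *∣p∣≤∑∈ B 1+X≤3d ⟩
      ∑[ e ∈ B ] (3 * d e)         ≡⟨ ∑∈-*ˡ 3 B d ⟩
      3 * ∑[ e ∈ B ] d e           ≤⟨ *-monoʳ-≤ 3 (∑edgeDeg≤4∣H∣ H B-matching) ⟩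
      3 * (4 * ∣ H ∣)               ≤⟨ *-monoʳ-≤ 3 (*-monoʳ-≤ 4 ∣H∣≤[1+X]∣M∣) ⟩
      3 * (4 * (suc X * ∣ M ∣))     ≡⟨ solve 2 (λ x y → con 3 :* (con 4 :* (x :* y)) := x :* (con 12 :* y))
                                             refl (suc X) ∣ M ∣ ⟩
      suc X * (12 * ∣ M ∣)         ∎)
    where
    open ≤-Reasoning
    d : Fin m → ℕ
    d = edgeDeg E H
    X : ℕ
    X = ⨆ M d
    1+X≤3d : ∀ e → e ∈ B → suc X ≤ 3 * d e
    1+X≤3d e e∈B = +-mono-≤ (proj₁ (heavy e e∈B)) (⨆-lub (λ g g∈M → proj₂ (heavy e e∈B) g (M⊆H g∈M)))
    ∣H∣≤[1+X]∣M∣ : ∣ H ∣ ≤ suc X * ∣ M ∣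
    ∣H∣≤[1+X]∣M∣ = begin
      ∣ H ∣              ≤⟨ ∣H∣≤∑edgeDeg M⊆H M-matching maximum ⟩
      ∑[ g ∈ M ] d g     ≤⟨ ∑∈≤*∣p∣ M (λ g → ≤⨆) ⟩
      X * ∣ M ∣          ≤⟨ *-monoˡ-≤ ∣ M ∣ (n≤1+n X) ⟩
      suc X * ∣ M ∣      ∎

  μ≤μ[K]+12μ[H] : ∀ {H K μG μH μK} →
                  IsMaxMatchingSize E ⊤ μG → IsMaxMatchingSize E H μH → IsMaxMatchingSize E K μK →
                  (∀ e → e ∉ K → Heavy H e) → μG ≤ μK + 12 * μH
  μ≤μ[K]+12μ[H] {H} {K} {μH = μH} {μK} ((MG , _ , MG-matching , refl) , _) maxH (_ , maximumK) heavy =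
    begin
      ∣ MG ∣                    ≡⟨ ∣p∣≡∣p∩q∣+∣p∩∁q∣ MG K ⟩
      ∣ MG ∩ K ∣ + ∣ MG ∩ ∁ K ∣ ≤⟨ +-mono-≤ light-part heavy-part ⟩
      μK + 12 * μH              ∎
    where
    open ≤-Reasoning
    light-part : ∣ MG ∩ K ∣ ≤ μK
    light-part = maximumK (MG ∩ K) (p∩q⊆q MG K) (IsMatching-⊆ (p∩q⊆p MG K) MG-matching)
    heavy-part : ∣ MG ∩ ∁ K ∣ ≤ 12 * μH
    heavy-part = heavy-matching-bound maxH (IsMatching-⊆ (p∩q⊆p MG (∁ K)) MG-matching)
                   (λ e e∈ → heavy e (x∈∁p⇒x∉p (p∩q⊆q MG (∁ K) e∈)))

module Thresholds where

  open import Data.Integer.Base using (+_)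
  import Data.Integer.Base as ℤ
  import Data.Integer.Properties as ℤ
  import Data.Nat.Base as ℕ
  import Data.Nat.Properties as ℕ
  import Data.Nat.Coprimality as Coprimality
  open import Data.Rational.Base
  open import Data.Rational.Properties
  open import Data.Rational.Solver using (module +-*-Solver)
  open +-*-Solver using (solve; _:+_; _:*_; :-_; _:=_; con)
  open import Data.Sum.Base using (_⊎_; inj₁; inj₂)
  open import Relation.Binary.PropositionalEquality using (_≡_; refl; sym; trans; cong; cong₂; subst; subst₂)
  open import Relation.Nullary using (¬_; yes; no)
  open import Relation.Nullary.Negation using (contradiction)

  private variable
    a b : ℕ
    ε β : ℚ

  toℚ≡mkℚ : ∀ k → toℚ k ≡ mkℚ (+ k) 0 (Coprimality.sym (Coprimality.1-coprimeTo k))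
  toℚ≡mkℚ k = normalize-coprime (Coprimality.sym (Coprimality.1-coprimeTo k))

  toℚ-mono-≤ : a ℕ.≤ b → toℚ a ≤ toℚ b
  toℚ-mono-≤ {a} {b} a≤b rewrite toℚ≡mkℚ a | toℚ≡mkℚ b =
    *≤* (subst₂ ℤ._≤_ (sym (ℤ.*-identityʳ (+ a))) (sym (ℤ.*-identityʳ (+ b))) (ℤ.+≤+ a≤b))

  toℚ-cancel-≤ : toℚ a ≤ toℚ b → a ℕ.≤ b
  toℚ-cancel-≤ {a} {b} a≤b rewrite toℚ≡mkℚ a | toℚ≡mkℚ b with a≤b
  ... | *≤* a*1≤b*1 = ℤ.drop‿+≤+ (subst₂ ℤ._≤_ (ℤ.*-identityʳ (+ a)) (ℤ.*-identityʳ (+ b)) a*1≤b*1)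

  toℚ-+ : ∀ a b → toℚ (a ℕ.+ b) ≡ toℚ a + toℚ b
  toℚ-+ a b rewrite toℚ≡mkℚ a | toℚ≡mkℚ b =
    cong (_/ 1) (trans (ℤ.pos-+ a b) (sym (cong₂ ℤ._+_ (ℤ.*-identityʳ (+ a)) (ℤ.*-identityʳ (+ b)))))

  toℚ-* : ∀ a b → toℚ (a ℕ.* b) ≡ toℚ a * toℚ b
  toℚ-* a b rewrite toℚ≡mkℚ a | toℚ≡mkℚ b = cong (_/ 1) (ℤ.pos-* a b)

  cβ : ℚ
  cβ = + 1 / 8

  0<cβ : 0ℚ < cβ
  0<cβ = *<* (ℤ.+<+ (ℕ.s≤s ℕ.z≤n))

  0≤½ : 0ℚ ≤ ½
  0≤½ = *≤* (ℤ.+≤+ ℕ.z≤n)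

  0<ε³ : 0ℚ < ε → 0ℚ < ε * ε * ε
  0<ε³ {ε} 0<ε = positive⁻¹ (ε * ε * ε)
    {{pos*pos⇒pos (ε * ε) {{pos*pos⇒pos ε {{positive 0<ε}} ε {{positive 0<ε}}}} ε {{positive 0<ε}}}}

  0<β : 0ℚ < ε → β * (ε * ε * ε) ≡ cβ → 0ℚ < β
  0<β {ε} {β} 0<ε βε³≡cβ with β ≤? 0ℚ
  ... | no β≰0 = ≰⇒> β≰0
  ... | yes β≤0 = contradiction (<-≤-trans 0<cβ (subst (_≤ 0ℚ) βε³≡cβ βε³≤0)) (<-irrefl refl)
    where
    βε³≤0 : β * (ε * ε * ε) ≤ 0ℚ
    βε³≤0 = ≤-trans (*-monoʳ-≤-nonNeg (ε * ε * ε) {{nonNegative (<⇒≤ (0<ε³ 0<ε))}} β≤0)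
                    (≤-reflexive (*-zeroˡ (ε * ε * ε)))

  cβ≤ε³ : ½ ≤ ε → cβ ≤ ε * ε * ε
  cβ≤ε³ {ε} ½≤ε = ≤-trans (*-monoʳ-≤-nonNeg ½ {{_}} ½²≤ε²) (*-monoˡ-≤-nonNeg (ε * ε) {{ε²≥0}} ½≤ε)
    where
    0≤ε : 0ℚ ≤ ε
    0≤ε = ≤-trans 0≤½ ½≤ε
    ε²≥0 : NonNegative (ε * ε)
    ε²≥0 = nonNegative (≤-trans (≤-reflexive (sym (*-zeroˡ ε))) (*-monoʳ-≤-nonNeg ε {{nonNegative 0≤ε}} 0≤ε))
    ½²≤ε² : ½ * ½ ≤ ε * ε
    ½²≤ε² = ≤-trans (*-monoʳ-≤-nonNeg ½ {{_}} ½≤ε) (*-monoˡ-≤-nonNeg ε {{nonNegative 0≤ε}} ½≤ε)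

  β≤1 : ½ < ε → β * (ε * ε * ε) ≡ cβ → β ≤ 1ℚ
  β≤1 {ε} {β} ½<ε βε³≡cβ with β ≤? 1ℚ
  ... | yes β≤1 = β≤1
  ... | no β≰1 = contradiction (≤-<-trans (cβ≤ε³ (<⇒≤ ½<ε)) ε³<cβ) (<-irrefl refl)
    where
    ε³<cβ : ε * ε * ε < cβ
    ε³<cβ = subst₂ _<_ (*-identityˡ (ε * ε * ε)) βε³≡cβ
              (*-monoˡ-<-pos (ε * ε * ε) {{positive (0<ε³ (<-trans 0<½ ½<ε))}} (≰⇒> β≰1))
      where
      0<½ : 0ℚ < ½
      0<½ = *<* (ℤ.+<+ (ℕ.s≤s ℕ.z≤n))

  0<1-ε : ε < 1ℚ → 0ℚ < 1ℚ - ε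
  0<1-ε {ε} ε<1 = subst (_< 1ℚ - ε) (+-inverseʳ ε) (+-monoˡ-< (- ε) ε<1)

  ¬underfull⇒1≤ : ε < 1ℚ → 0ℚ < β → ¬ toℚ a < (1ℚ - ε) * β → 1 ℕ.≤ a
  ¬underfull⇒1≤ {ε} {β} {ℕ.zero}  ε<1 0<β ¬underfull = contradiction 0<[1-ε]β ¬underfull
    where
    0<[1-ε]β : 0ℚ < (1ℚ - ε) * β
    0<[1-ε]β = positive⁻¹ ((1ℚ - ε) * β)
                 {{pos*pos⇒pos (1ℚ - ε) {{positive (0<1-ε ε<1)}} β {{positive 0<β}}}}
  ¬underfull⇒1≤ {a = ℕ.suc a} _ _ _ = ℕ.s≤s ℕ.z≤n

  β≤2[1-ε]β : ε ≤ ½ → 0ℚ ≤ β → β ≤ toℚ 2 * ((1ℚ - ε) * β)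
  β≤2[1-ε]β {ε} {β} ε≤½ 0≤β = subst (_≤ toℚ 2 * ((1ℚ - ε) * β)) (β≡2*½β β)
    (*-monoˡ-≤-nonNeg (toℚ 2) {{_}} (*-monoʳ-≤-nonNeg β {{nonNegative 0≤β}} ½≤1-ε))
    where
    ½≤1-ε : ½ ≤ 1ℚ - ε
    ½≤1-ε = +-monoʳ-≤ 1ℚ (neg-antimono-≤ ε≤½)
    β≡2*½β : ∀ x → toℚ 2 * (½ * x) ≡ x
    β≡2*½β = solve 1 (λ x → con (toℚ 2) :* (con ½ :* x) := x) refl

  ¬overfull∧¬underfull⇒≤2* : 0ℚ < ε → ε < 1ℚ → β * (ε * ε * ε) ≡ cβ →
                              ¬ toℚ b > β → ¬ toℚ a < (1ℚ - ε) * β → b ℕ.≤ 2 ℕ.* a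
  ¬overfull∧¬underfull⇒≤2* {ε} {β} {b} {a} 0<ε ε<1 βε³≡cβ ¬overfull ¬underfull with ε ≤? ½
  ... | yes ε≤½ = toℚ-cancel-≤ (begin
    toℚ b                  ≤⟨ ≮⇒≥ ¬overfull ⟩
    β                      ≤⟨ β≤2[1-ε]β ε≤½ (<⇒≤ (0<β 0<ε βε³≡cβ)) ⟩
    toℚ 2 * ((1ℚ - ε) * β) ≤⟨ *-monoˡ-≤-nonNeg (toℚ 2) {{_}} (≮⇒≥ ¬underfull) ⟩
    toℚ 2 * toℚ a          ≡⟨ toℚ-* 2 a ⟨
    toℚ (2 ℕ.* a)          ∎)
    where open ≤-Reasoning
  -- For ε > ½ the normalisation β ε³ = 1/8 forces β ≤ 1, so H-degrees are at most 1.
  ... | no ε≰½ = ℕ.≤-trans b≤1 (ℕ.≤-trans 1≤a (ℕ.m≤m+n a (a ℕ.+ 0)))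
    where
    b≤1 : b ℕ.≤ 1
    b≤1 = toℚ-cancel-≤ (≤-trans (≮⇒≥ ¬overfull) (β≤1 (≰⇒> ε≰½) βε³≡cβ))
    1≤a : 1 ℕ.≤ a
    1≤a = ¬underfull⇒1≤ ε<1 (0<β 0<ε βε³≡cβ) ¬underfull

  c₁ : ℚ
  c₁ = + 1 / 24

  0<c₁ : 0ℚ < c₁
  0<c₁ = *<* (ℤ.+<+ (ℕ.s≤s ℕ.z≤n))

  dichotomy : ∀ {x y z} → 0ℚ < ε → ε < 1ℚ → x ℕ.≤ y ℕ.+ 12 ℕ.* z →
              (c₁ * ε * toℚ x ≤ toℚ z) ⊎ (toℚ x ≤ (1ℚ + 1ℚ * ε) * toℚ y)
  dichotomy {ε} {x} {y} {z} 0<ε ε<1 x≤y+12z with c₁ * ε * toℚ x ≤? toℚ z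
  ... | yes c₁εx≤z = inj₁ c₁εx≤z
  ... | no c₁εx≰z = inj₂ (begin
    X                     ≤⟨ X≤Y+½εX ⟩
    Y + ½ * (ε * X)       ≡⟨ solve 3 (λ y e x → y :+ con ½ :* (e :* x) := y :+ e :* (con ½ :* x)) refl Y ε X ⟩
    Y + ε * (½ * X)       ≤⟨ +-monoʳ-≤ Y (*-monoˡ-≤-nonNeg ε {{nonNegative (<⇒≤ 0<ε)}} ½X≤Y) ⟩
    Y + ε * Y             ≡⟨ solve 2 (λ y e → y :+ e :* y := (con 1ℚ :+ con 1ℚ :* e) :* y) refl Y ε ⟩
    (1ℚ + 1ℚ * ε) * Y     ∎)
    where
    open ≤-Reasoning
    X Y Z : ℚ
    X = toℚ x
    Y = toℚ y
    Z = toℚ z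
    X≤Y+½εX : X ≤ Y + ½ * (ε * X)
    X≤Y+½εX = begin
      X                       ≤⟨ toℚ-mono-≤ x≤y+12z ⟩
      toℚ (y ℕ.+ 12 ℕ.* z)    ≡⟨ trans (toℚ-+ y (12 ℕ.* z)) (cong (_+_ Y) (toℚ-* 12 z)) ⟩
      Y + toℚ 12 * Z          ≤⟨ +-monoʳ-≤ Y (*-monoˡ-≤-nonNeg (toℚ 12) {{_}} (<⇒≤ (≰⇒> c₁εx≰z))) ⟩
      Y + toℚ 12 * (c₁ * ε * X) ≡⟨ solve 3 (λ y e x → y :+ con (toℚ 12) :* (con c₁ :* e :* x)
                                                    := y :+ con ½ :* (e :* x)) refl Y ε X ⟩
      Y + ½ * (ε * X)         ∎
    ½X≤Y : ½ * X ≤ Y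
    ½X≤Y = subst₂ _≤_ (solve 1 (λ x → x :+ :- (con ½ :* x) := con ½ :* x) refl X)
                      (solve 2 (λ y x → y :+ con ½ :* x :+ :- (con ½ :* x) := y) refl Y X)
                      (+-monoˡ-≤ (- (½ * X)) X≤Y+½X)
      where
      εX≤X : ε * X ≤ X
      εX≤X = subst (ε * X ≤_) (*-identityˡ X)
                   (*-monoʳ-≤-nonNeg X {{nonNegative (toℚ-mono-≤ {b = x} ℕ.z≤n)}} (<⇒≤ ε<1))
      X≤Y+½X : X ≤ Y + ½ * X
      X≤Y+½X = ≤-trans X≤Y+½εX (+-monoʳ-≤ Y (*-monoˡ-≤-nonNeg ½ {{_}} εX≤X))

open import Data.Fin using (Fin)
open import Data.Fin.Subset using (Subset; _∈_; _∉_; _∪_; ⊤)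
open import Data.Product using (_×_; Σ)
open import Data.Sum using (_⊎_)
open import Data.Rational using (ℚ; 0ℚ; 1ℚ; _+_; _*_; _<_; _≤_)
open import Function.Bundles using (_⇔_)
open import Relation.Binary.PropositionalEquality using (_≡_)

open import Data.Fin.Subset.Properties using (p⊆p∪q; q⊆p∪q)
open import Data.Product using (_,_)
open import Data.Rational.Properties using (positive⁻¹)
open import Function.Base using (_∘_)
open import Function.Bundles using (module Equivalence)
open import Relation.Nullary using (¬_)
open Matchings using (Heavy; μ≤μ[K]+12μ[H])
open Thresholds

outside-H∪U⇒Heavy : ∀ {ε β n m} (E : EdgeList n m) {H U : Subset m} →
                    0ℚ < ε → ε < 1ℚ → β * (ε * ε * ε) ≡ cβ → IsEDBS E β H →
                    (∀ e → e ∉ H → Underfull E ε β H e → e ∈ U) →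
                    ∀ e → e ∉ H ∪ U → Heavy E H e
outside-H∪U⇒Heavy {ε} {β} E {H} {U} 0<ε ε<1 βε³≡cβ edbs underfull⇒∈U e e∉H∪U =
  ¬underfull⇒1≤ ε<1 (0<β 0<ε βε³≡cβ) ¬underfull ,
  λ g g∈H → ¬overfull∧¬underfull⇒≤2* {a = edgeDeg E H e} 0<ε ε<1 βε³≡cβ (edbs g g∈H) ¬underfull
  where
  ¬underfull : ¬ Underfull E ε β H e
  ¬underfull underfull = e∉H∪U (q⊆p∪q H U (underfull⇒∈U e (e∉H∪U ∘ p⊆p∪q U) underfull))

lemma5p2 : Σ ℚ λ cβ → Σ ℚ λ c₁ → Σ ℚ λ c₂ →
    0ℚ < cβ × 0ℚ < c₁ × 0ℚ < c₂ ×
    (∀ (ε β : ℚ) → 0ℚ < ε → ε < 1ℚ → β * (ε * ε * ε) ≡ cβ →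
     ∀ (n m : ℕ) (E : EdgeList n m) → Simple E →
     ∀ (H U : Subset m) → IsEDBS E β H →
     (∀ e → (e ∈ U) ⇔ (e ∉ H × Underfull E ε β H e)) →
     ∀ (μG μH μHU : ℕ) →
     IsMaxMatchingSize E ⊤ μG → IsMaxMatchingSize E H μH →
     IsMaxMatchingSize E (H ∪ U) μHU →
     (c₁ * ε * toℚ μG ≤ toℚ μH) ⊎ (toℚ μG ≤ (1ℚ + c₂ * ε) * toℚ μHU))
lemma5p2 = cβ , c₁ , 1ℚ , 0<cβ , 0<c₁ , positive⁻¹ 1ℚ ,
  λ ε β 0<ε ε<1 βε³≡cβ n m E _ H U edbs U-spec μG μH μHU maxG maxH maxHU →
    dichotomy {x = μG} {μHU} {μH} 0<ε ε<1 (μ≤μ[K]+12μ[H] E maxG maxH maxHU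
      (outside-H∪U⇒Heavy {ε} {β} E 0<ε ε<1 βε³≡cβ edbs
        (λ e e∉H → Equivalence.from (U-spec e) ∘ (e∉H ,_))))
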